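{- Let $D$ be an Arakelov divisor on $\overline{\operatorname{Spec}{\mathbb Z}}$ with $\deg(D)\geq 0$. Then $$\dim_{\mathbb S} H^0(D)=\lceil \deg_2 D\rceil+1,$$ where $\deg_2 D:=\deg(D)/\log 2$ and $\lceil x\rceil$ denotes the smallest integer strictly greater than $x$.
   Context: An Arakelov divisor on $\overline{\operatorname{Spec}{\mathbb Z}}$ is a formal sum $D=\sum_p a_p\{p\}+a_\infty\{\infty\}$ (finitely many nonzero $a_p\in{\mathbb Z}$, $a_\infty\in{\mathbb R}$), with $\deg D=\sum_p a_p\log p+a_\infty$. Its $H^0(D)$ is the ${\mathbb S}$-module which (via the classical relation between the degree and the associated compact subset of adeles, after reduction to $D=\deg(D)\{\infty\}$) is the ${\mathbb S}$-module $(H{\mathbb Z})_I$ with $I=[-e^{\deg D},e^{\deg D}]\cap{\mathbb Z}$, where for $X\subset{\mathbb Z}$ containing $0$, $(H{\mathbb Z})_X(k_+)=\{a\in{\mathbb Z}^k\mid \sum_{j\in Z}a_j\in X\ \forall Z\subset\{1,\dots,k\}\}$ (with $k_+=\{*,1,\dots,k\}$). Its dimension $\dim_{\mathbb S}$ is the smallest cardinality of a subset $G\subset I$ such that for every $x\in I$ there is $Z\subset G$ with $\sum_{g\in Z}g=x$ and $\sum_{g\in Z'}g\in I$ for all $Z'\subset Z$. -}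

module Defs where

open import Data.Nat using (ℕ; _≤_; _<_; _+_; _^_)
open import Data.Integer as ℤ using (ℤ; ∣_∣)
open import Data.List using (List; foldr; length)
open import Data.List.Relation.Unary.All using (All)
open import Data.List.Relation.Unary.Unique.Propositional using (Unique)
open import Data.List.Relation.Binary.Sublist.Propositional using (_⊆_)
open import Data.Product using (Σ; ∃; _×_)
open import Relation.Binary.PropositionalEquality using (_≡_)

-- The set I_N = [-N, N] ∩ ℤ, as a predicate on ℤ.
-- For D with deg D ≥ 0, H⁰(D) is (HZ)_I with I = [-e^{deg D}, e^{deg D}] ∩ ℤ = I_N
-- where N = ⌊e^{deg D}⌋ ≥ 1.
InI : ℕ → ℤ → Set
InI N x = ∣ x ∣ ≤ N

sumℤ : List ℤ → ℤ
sumℤ = foldr ℤ._+_ (ℤ.+ 0)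

-- A finite subset G ⊂ I_N is a duplicate-free list of elements of I_N;
-- subsets Z ⊂ G are sublists of G.
Generates : ℕ → List ℤ → Set
Generates N G =
  Unique G × All (InI N) G ×
  (∀ x → InI N x →
     Σ (List ℤ) λ Z → Z ⊆ G × sumℤ Z ≡ x ×
       (∀ Z′ → Z′ ⊆ Z → InI N (sumℤ Z′)))

DimS≡ : ℕ → ℕ → Set
DimS≡ N d =
  (Σ (List ℤ) λ G → Generates N G × length G ≡ d) ×
  (∀ G → Generates N G → d ≤ length G)

-- n is ⌈ deg₂ D ⌉ (smallest integer strictly greater than log₂ e^{deg D}):
-- the least n with e^{deg D} < 2^n, equivalently (as 2^n is an integer) N < 2^n.
IsCeilLog2 : ℕ → ℕ → Set
IsCeilLog2 N n = N < 2 ^ n × (∀ m → N < 2 ^ m → n ≤ m)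

{-# OPTIONS --safe #-}
-- Lower bound: every element of I_N = [-N, N] must be a subset sum of a generating set G,
-- and G has only 2^|G| subset sums, so 2N + 1 ≤ 2^|G|; with 2^(n-1) ≤ N this forces |G| > n.
-- Upper bound: G = {-N, 1, 2, …, 2^(n-1)} generates. A nonnegative a ≤ N < 2^n is the sum of
-- its binary digits, whose sub-sums lie in [0, a]; a negative x is -N plus the binary digits
-- of N + x, whose sub-sums lie in [-N, 0] ∪ [0, N + x].
module Submission where

open import Defs
open import Data.Nat using (ℕ; zero; suc; _+_; _∸_; _^_; _≤_; _<_; _≤?_; s≤s; NonZero)
import Data.Nat.Properties as ℕₚ
open import Data.Integer as ℤ using (ℤ; +_; -[1+_]; 0ℤ; +≤+; +<+)
import Data.Integer.Properties as ℤₚ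
open import Data.Fin using (Fin; toℕ)
import Data.Fin.Properties as Finₚ
open import Data.List using (List; []; _∷_; _++_; map; length)
open import Data.List.Properties using (length-++; length-map)
open import Data.List.Relation.Unary.All as All using (All; []; _∷_)
open import Data.List.Relation.Unary.Any using (here)
import Data.List.Relation.Unary.AllPairs as AllPairs
open import Data.List.Relation.Unary.Unique.Propositional using (Unique)
open import Data.List.Relation.Binary.Sublist.Propositional
  using (_⊆_; []; _∷ʳ_; _∷_; ⊆-refl; ⊆-trans)
open import Data.List.Relation.Binary.Sublist.Propositional.Properties using (All-resp-⊆)
open import Data.List.Membership.Propositional using (_∈_)
open import Data.List.Membership.Propositional.Properties using (∈-++⁺ˡ; ∈-++⁺ʳ; ∈-map⁺)
open import Data.List.Membership.Setoid.Properties using (index-injective)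
open import Data.Product using (Σ; _×_; _,_)
open import Data.Sum using (inj₁; inj₂)
open import Function using (_∘′_)
open import Function.Definitions using (Injective)
open import Relation.Binary.PropositionalEquality
open import Relation.Nullary using (yes; no; contradiction)
open import Algebra.Properties.AbelianGroup ℤₚ.+-0-abelianGroup using (∙-cancelˡ)

private
  variable
    N k a b : ℕ
    x s : ℤ
    G H Z Z′ : List ℤ

AllSubsums : (ℤ → Set) → List ℤ → Set
AllSubsums P Z = ∀ Z′ → Z′ ⊆ Z → P (sumℤ Z′)

Expressible : ℕ → List ℤ → ℤ → Set
Expressible N G x = Σ (List ℤ) λ Z → Z ⊆ G × sumℤ Z ≡ x × AllSubsums (InI N) Z

2^[1+k]≡2^k+2^k : ∀ k → 2 ^ suc k ≡ 2 ^ k + 2 ^ k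
2^[1+k]≡2^k+2^k k = cong (_+_ (2 ^ k)) (ℕₚ.+-identityʳ (2 ^ k))

^-cancelʳ-< : ∀ b .{{_ : NonZero b}} {m n} → b ^ m < b ^ n → m < n
^-cancelʳ-< b bᵐ<bⁿ = ℕₚ.≰⇒> (λ n≤m → ℕₚ.<⇒≱ bᵐ<bⁿ (ℕₚ.^-monoʳ-≤ b n≤m))

injective-∈⇒≤-length : ∀ {A : Set} {xs : List A} (f : Fin k → A) →
                       Injective _≡_ _≡_ f → (∀ i → f i ∈ xs) → k ≤ length xs
injective-∈⇒≤-length f f-inj f∈xs =
  Finₚ.injective⇒≤ (λ {i} {j} → f-inj ∘′ index-injective (setoid _) (f∈xs i) (f∈xs j))

subsetSums : List ℤ → List ℤ
subsetSums []      = 0ℤ ∷ []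
subsetSums (g ∷ G) = subsetSums G ++ map (ℤ._+_ g) (subsetSums G)

length-subsetSums : ∀ G → length (subsetSums G) ≡ 2 ^ length G
length-subsetSums [] = refl
length-subsetSums (g ∷ G) = begin
  length (subsetSums G ++ map (ℤ._+_ g) (subsetSums G))   ≡⟨ length-++ (subsetSums G) ⟩
  length (subsetSums G) + length (map (ℤ._+_ g) (subsetSums G))
    ≡⟨ cong (_+_ (length (subsetSums G))) (length-map (ℤ._+_ g) (subsetSums G)) ⟩
  length (subsetSums G) + length (subsetSums G)           ≡⟨ cong (λ t → t + t) (length-subsetSums G) ⟩
  2 ^ length G + 2 ^ length G                             ≡⟨ 2^[1+k]≡2^k+2^k (length G) ⟨
  2 ^ suc (length G)                                      ∎
  where open ≡-Reasoning

sumℤ∈subsetSums : Z ⊆ G → sumℤ Z ∈ subsetSums G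
sumℤ∈subsetSums []                         = here refl
sumℤ∈subsetSums (_ ∷ʳ Z⊆G)                 = ∈-++⁺ˡ (sumℤ∈subsetSums Z⊆G)
sumℤ∈subsetSums {G = g ∷ G} (refl ∷ Z⊆G) =
  ∈-++⁺ʳ (subsetSums G) (∈-map⁺ (ℤ._+_ g) (sumℤ∈subsetSums Z⊆G))

expressible⇒∈subsetSums : Expressible N G x → x ∈ subsetSums G
expressible⇒∈subsetSums (_ , Z⊆G , refl , _) = sumℤ∈subsetSums Z⊆G

InI-shift : b ≤ N + N → InI N (ℤ.- + N ℤ.+ + b)
InI-shift {b} {N} b≤2N rewrite ℤₚ.-m+n≡n⊖m N b with ℕₚ.≤-total b N
... | inj₁ b≤N = ℕₚ.≤-trans (ℕₚ.≤-reflexive (ℤₚ.∣⊖∣-≤ b≤N)) (ℕₚ.m∸n≤m N b)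
... | inj₂ N≤b rewrite ℤₚ.⊖-≥ N≤b = ℕₚ.m≤n+o⇒m∸n≤o b N b≤2N

interval : (N : ℕ) → Fin (suc (N + N)) → ℤ
interval N i = ℤ.- + N ℤ.+ + toℕ i

interval-injective : ∀ N → Injective _≡_ _≡_ (interval N)
interval-injective N eq = Finₚ.toℕ-injective (ℤₚ.+-injective (∙-cancelˡ (ℤ.- + N) _ _ eq))

interval-InI : ∀ i → InI N (interval N i)
interval-InI i = InI-shift (ℕₚ.≤-pred (Finₚ.toℕ<n i))

generates⇒2N+1≤2^length : Generates N G → suc (N + N) ≤ 2 ^ length G
generates⇒2N+1≤2^length {N} {G} (_ , _ , expressible) =
  subst (suc (N + N) ≤_) (length-subsetSums G)
    (injective-∈⇒≤-length (interval N) (interval-injective N)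
      (λ i → expressible⇒∈subsetSums (expressible _ (interval-InI i))))

AllSubsums-∷ : ∀ {P : ℤ → Set} g → AllSubsums P Z → AllSubsums (λ s → P (g ℤ.+ s)) Z →
               AllSubsums P (g ∷ Z)
AllSubsums-∷ g all-P all-P[g+] Z′       (_ ∷ʳ Z′⊆Z)   = all-P Z′ Z′⊆Z
AllSubsums-∷ g all-P all-P[g+] (_ ∷ Z′) (refl ∷ Z′⊆Z) = all-P[g+] Z′ Z′⊆Z

sumℤ-⊆-bounds : All (0ℤ ℤ.≤_) Z → Z′ ⊆ Z → 0ℤ ℤ.≤ sumℤ Z′ × sumℤ Z′ ℤ.≤ sumℤ Z
sumℤ-⊆-bounds []            []            = ℤₚ.≤-refl , ℤₚ.≤-refl
sumℤ-⊆-bounds (0≤z ∷ 0≤Z) (z ∷ʳ Z′⊆Z) with sumℤ-⊆-bounds 0≤Z Z′⊆Z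
... | 0≤s , s≤ΣZ = 0≤s , ℤₚ.i≤j⇒i≤k+j z {{ℤ.nonNegative 0≤z}} s≤ΣZ
sumℤ-⊆-bounds {Z = z ∷ _} (0≤z ∷ 0≤Z) (refl ∷ Z′⊆Z) with sumℤ-⊆-bounds 0≤Z Z′⊆Z
... | 0≤s , s≤ΣZ = ℤₚ.+-mono-≤ 0≤z 0≤s , ℤₚ.+-monoʳ-≤ z s≤ΣZ

Expressible-⊆ : G ⊆ H → Expressible N G x → Expressible N H x
Expressible-⊆ G⊆H (Z , Z⊆G , ΣZ≡x , subsums) = Z , ⊆-trans Z⊆G G⊆H , ΣZ≡x , subsums

powersOfTwo : ℕ → List ℤ
powersOfTwo zero    = []
powersOfTwo (suc k) = + (2 ^ k) ∷ powersOfTwo k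

length-powersOfTwo : ∀ k → length (powersOfTwo k) ≡ k
length-powersOfTwo zero    = refl
length-powersOfTwo (suc k) = cong suc (length-powersOfTwo k)

powersOfTwo-positive : ∀ k → All (0ℤ ℤ.<_) (powersOfTwo k)
powersOfTwo-positive zero    = []
powersOfTwo-positive (suc k) = +<+ (ℕₚ.m^n>0 2 k) ∷ powersOfTwo-positive k

powersOfTwo-< : ∀ k → All (ℤ._< + (2 ^ k)) (powersOfTwo k)
powersOfTwo-< zero    = []
powersOfTwo-< (suc k) =
  2^k<2^[1+k] ∷ All.map (λ y<2^k → ℤₚ.<-trans y<2^k 2^k<2^[1+k]) (powersOfTwo-< k)
  where
  2^k<2^[1+k] : + (2 ^ k) ℤ.< + (2 ^ suc k)
  2^k<2^[1+k] = +<+ (ℕₚ.^-monoʳ-< 2 (ℕₚ.n<1+n 1) (ℕₚ.n<1+n k))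

unique-powersOfTwo : ∀ k → Unique (powersOfTwo k)
unique-powersOfTwo zero    = AllPairs.[]
unique-powersOfTwo (suc k) =
  All.map (λ y<2^k → ≢-sym (ℤₚ.<⇒≢ y<2^k)) (powersOfTwo-< k) AllPairs.∷ unique-powersOfTwo k

powersOfTwo-InI : ∀ k → 2 ^ k ≤ N → All (InI N) (powersOfTwo (suc k))
powersOfTwo-InI zero    1≤N        = 1≤N ∷ []
powersOfTwo-InI (suc k) 2^[1+k]≤N =
  2^[1+k]≤N ∷ powersOfTwo-InI k (ℕₚ.≤-trans (ℕₚ.^-monoʳ-≤ 2 (ℕₚ.n≤1+n k)) 2^[1+k]≤N)

binaryDigits : ℕ → ℕ → List ℤ
binaryDigits zero    a = []
binaryDigits (suc k) a with 2 ^ k ≤? a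
... | yes _ = + (2 ^ k) ∷ binaryDigits k (a ∸ 2 ^ k)
... | no  _ = binaryDigits k a

binaryDigits-⊆ : ∀ k a → binaryDigits k a ⊆ powersOfTwo k
binaryDigits-⊆ zero    a = []
binaryDigits-⊆ (suc k) a with 2 ^ k ≤? a
... | yes _ = refl ∷ binaryDigits-⊆ k (a ∸ 2 ^ k)
... | no  _ = + (2 ^ k) ∷ʳ binaryDigits-⊆ k a

sumℤ-binaryDigits : ∀ k → a < 2 ^ k → sumℤ (binaryDigits k a) ≡ + a
sumℤ-binaryDigits {zero}  zero    _         = refl
sumℤ-binaryDigits {suc _} zero    (s≤s ())
sumℤ-binaryDigits {a}     (suc k) a<2^[1+k] with 2 ^ k ≤? a
... | no  2^k≰a  = sumℤ-binaryDigits k (ℕₚ.≰⇒> 2^k≰a)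
... | yes 2^k≤a = begin
  + (2 ^ k) ℤ.+ sumℤ (binaryDigits k (a ∸ 2 ^ k))
    ≡⟨ cong (ℤ._+_ (+ (2 ^ k))) (sumℤ-binaryDigits k a∸2^k<2^k) ⟩
  + (2 ^ k + (a ∸ 2 ^ k))                          ≡⟨ cong +_ (ℕₚ.m+[n∸m]≡n 2^k≤a) ⟩
  + a                                              ∎
  where
  open ≡-Reasoning
  a∸2^k<2^k : a ∸ 2 ^ k < 2 ^ k
  a∸2^k<2^k = ℕₚ.m<n+o⇒m∸n<o a (2 ^ k) {{ℕₚ.m^n≢0 2 k}}
                (subst (a <_) (2^[1+k]≡2^k+2^k k) a<2^[1+k])

binaryDigits-subsums : ∀ k → a < 2 ^ k →
                       AllSubsums (λ s → 0ℤ ℤ.≤ s × s ℤ.≤ + a) (binaryDigits k a)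
binaryDigits-subsums {a} k a<2^k Z′ Z′⊆D =
  subst (λ t → 0ℤ ℤ.≤ sumℤ Z′ × sumℤ Z′ ℤ.≤ t) (sumℤ-binaryDigits k a<2^k)
    (sumℤ-⊆-bounds digits-nonneg Z′⊆D)
  where
  digits-nonneg : All (0ℤ ℤ.≤_) (binaryDigits k a)
  digits-nonneg = All-resp-⊆ (binaryDigits-⊆ k a) (All.map ℤₚ.<⇒≤ (powersOfTwo-positive k))

0≤s≤a⇒InI : a ≤ N → 0ℤ ℤ.≤ s × s ℤ.≤ + a → InI N s
0≤s≤a⇒InI a≤N (+≤+ _ , +≤+ b≤a) = ℕₚ.≤-trans b≤a a≤N

0≤s≤a⇒InI-shift : a ≤ N → 0ℤ ℤ.≤ s × s ℤ.≤ + a → InI N (ℤ.- + N ℤ.+ s)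
0≤s≤a⇒InI-shift {N = N} a≤N (+≤+ _ , +≤+ b≤a) =
  InI-shift (ℕₚ.≤-trans (ℕₚ.≤-trans b≤a a≤N) (ℕₚ.m≤m+n N N))

expressible-binary : N < 2 ^ k → a ≤ N → Expressible N (powersOfTwo k) (+ a)
expressible-binary {N} {k} {a} N<2^k a≤N =
  binaryDigits k a , binaryDigits-⊆ k a , sumℤ-binaryDigits k a<2^k ,
  λ Z′ Z′⊆D → 0≤s≤a⇒InI a≤N (binaryDigits-subsums k a<2^k Z′ Z′⊆D)
  where
  a<2^k : a < 2 ^ k
  a<2^k = ℕₚ.≤-<-trans a≤N N<2^k

expressible-shifted-binary : N < 2 ^ k → a ≤ N →
                             Expressible N (ℤ.- + N ∷ powersOfTwo k) (ℤ.- + N ℤ.+ + a)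
expressible-shifted-binary {N} {k} {a} N<2^k a≤N =
  ℤ.- + N ∷ binaryDigits k a , refl ∷ binaryDigits-⊆ k a ,
  cong (ℤ._+_ (ℤ.- + N)) (sumℤ-binaryDigits k a<2^k) ,
  AllSubsums-∷ {P = InI N} (ℤ.- + N) (λ Z′ Z′⊆D → 0≤s≤a⇒InI a≤N (digit-subsums Z′ Z′⊆D))
                                    (λ Z′ Z′⊆D → 0≤s≤a⇒InI-shift a≤N (digit-subsums Z′ Z′⊆D))
  where
  a<2^k : a < 2 ^ k
  a<2^k = ℕₚ.≤-<-trans a≤N N<2^k
  digit-subsums : AllSubsums (λ s → 0ℤ ℤ.≤ s × s ℤ.≤ + a) (binaryDigits k a)
  digit-subsums = binaryDigits-subsums k a<2^k

-N+[N∸[1+j]]≡-[1+j] : ∀ {j} → suc j ≤ N → ℤ.- + N ℤ.+ + (N ∸ suc j) ≡ -[1+ j ]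
-N+[N∸[1+j]]≡-[1+j] {N} {j} 1+j≤N = begin
  ℤ.- + N ℤ.+ + (N ∸ suc j) ≡⟨ ℤₚ.-m+n≡n⊖m N (N ∸ suc j) ⟩
  (N ∸ suc j) ℤ.⊖ N         ≡⟨ ℤₚ.⊖-≤ (ℕₚ.m∸n≤m N (suc j)) ⟩
  ℤ.- + (N ∸ (N ∸ suc j))   ≡⟨ cong (λ t → ℤ.- + t) (ℕₚ.m∸[m∸n]≡n 1+j≤N) ⟩
  -[1+ j ]                  ∎
  where open ≡-Reasoning

binaryGenerators : ℕ → ℕ → List ℤ
binaryGenerators N k = ℤ.- + N ∷ powersOfTwo k

binaryGenerators-generate : ∀ m → 2 ^ m ≤ N → N < 2 ^ suc m →
                            Generates N (binaryGenerators N (suc m))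
binaryGenerators-generate {N} m 2^m≤N N<2^[1+m] =
  (-N∉powers AllPairs.∷ unique-powersOfTwo (suc m)) ,
  (ℕₚ.≤-reflexive (ℤₚ.∣-i∣≡∣i∣ (+ N)) ∷ powersOfTwo-InI m 2^m≤N) ,
  expressible
  where
  -N∉powers : All (ℤ.- + N ≢_) (powersOfTwo (suc m))
  -N∉powers =
    All.map (λ 0<y → ℤₚ.<⇒≢ (ℤₚ.≤-<-trans ℤₚ.neg-≤-pos 0<y)) (powersOfTwo-positive (suc m))
  expressible : ∀ x → InI N x → Expressible N (binaryGenerators N (suc m)) x
  expressible (+ a)    a≤N   = Expressible-⊆ (_ ∷ʳ ⊆-refl) (expressible-binary N<2^[1+m] a≤N)
  expressible -[1+ j ] 1+j≤N = subst (Expressible N _) (-N+[N∸[1+j]]≡-[1+j] 1+j≤N)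
                                 (expressible-shifted-binary N<2^[1+m] (ℕₚ.m∸n≤m N (suc j)))

theorem3p3 : (N n : ℕ) → 1 ≤ N → IsCeilLog2 N n → DimS≡ N (n + 1)
theorem3p3 N zero    1≤N (N<1 , _)            = contradiction N<1 (ℕₚ.≤⇒≯ 1≤N)
theorem3p3 N (suc m) _   (N<2^[1+m] , minimal) =
  (binaryGenerators N (suc m) , binaryGenerators-generate m 2^m≤N N<2^[1+m] , length-generators) ,
  λ G G-generates → at-least-n+1 (generates⇒2N+1≤2^length G-generates)
  where
  2^m≤N : 2 ^ m ≤ N
  2^m≤N = ℕₚ.≮⇒≥ (λ N<2^m → ℕₚ.1+n≰n (minimal m N<2^m))
  length-generators : length (binaryGenerators N (suc m)) ≡ suc m + 1
  length-generators = trans (cong suc (length-powersOfTwo (suc m))) (ℕₚ.+-comm 1 (suc m))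
  at-least-n+1 : ∀ {l} → suc (N + N) ≤ 2 ^ l → suc m + 1 ≤ l
  at-least-n+1 {l} 2N<2^l = subst (_≤ l) (ℕₚ.+-comm 1 (suc m)) (^-cancelʳ-< 2 (begin-strict
    2 ^ suc m     ≡⟨ 2^[1+k]≡2^k+2^k m ⟩
    2 ^ m + 2 ^ m ≤⟨ ℕₚ.+-mono-≤ 2^m≤N 2^m≤N ⟩
    N + N         <⟨ 2N<2^l ⟩
    2 ^ l         ∎))
    where open ℕₚ.≤-Reasoning
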